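{- For any integers $n,m\geq 0$ and any partition $\mu$ such that $\mu_1\leq n$ there holds $$q^{\binom{m}{2}+n(\mu)}\left[{n\atop m}\right]\left[{n\atop \mu}\right]=\sum_{\lambda}q^{n(\lambda)}\left[{n\atop \lambda}\right]\prod_{i\geq 1}\left[{\lambda_i-\lambda_{i+1}\atop \lambda_i-\mu_i}\right],$$ where the sum is over all partitions $\lambda$ such that $\lambda/\mu$ is an $m$-horizontal strip, i.e., $\mu\subseteq\lambda$, $|\lambda/\mu|=m$ and there is at most one cell in each column of the Ferrers diagram of $\lambda/\mu$.
   Context: Notation: $(x)_0=1$, $(x)_n=\prod_{k=1}^n(1-xq^{k-1})$. For a partition $\lambda$, $n(\lambda)=\sum_i\binom{\lambda_i}{2}$, $(x)_\lambda=(x)_{\lambda_1-\lambda_2}(x)_{\lambda_2-\lambda_3}\cdots$, and the general $q$-binomial coefficient is $\left[{n\atop \lambda}\right]=\frac{(q)_n}{(q)_{n-\lambda_1}(q)_\lambda}$, with $\left[{n\atop \lambda}\right]=0$ if $\lambda_1>n$; for $\lambda=(m)$ this is the classical $q$-binomial coefficient $\left[{n\atop m}\right]=\frac{(q)_n}{(q)_{n-m}(q)_m}$. -}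

module Defs where

open import Data.Nat as ℕ using (ℕ; zero; suc; _∸_; _<_; _≤_; _<ᵇ_)
open import Data.Nat.Combinatorics using (_C_)
open import Data.Nat.ListAction using (sum)
open import Data.Bool using (if_then_else_)
open import Data.List as List using (List; []; _∷_; length; upTo; map)
open import Data.List.Relation.Unary.All using (All)
open import Data.List.Relation.Unary.Linked using (Linked)
open import Data.Rational as ℚ using (ℚ; 0ℚ; 1ℚ; _*_; _÷_; ≢-nonZero)
open import Data.Rational.Properties using (_≟_)
open import Relation.Nullary using (yes; no)
open import Relation.Binary.PropositionalEquality using (_≡_)
open import Data.Product using (_×_)

pow : ℚ → ℕ → ℚ
pow q zero    = 1ℚ
pow q (suc k) = q * pow q k

-- Total division: p / r if r ≠ 0, and 0 otherwise.  (All denominators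
-- occurring in the statement are nonzero under the hypotheses q ≠ ±1.)
_/?_ : ℚ → ℚ → ℚ
p /? r with r ≟ 0ℚ
... | yes _  = 0ℚ
... | no r≢0 = _÷_ p r {{≢-nonZero r≢0}}

poch : ℚ → ℚ → ℕ → ℚ
poch q x zero    = 1ℚ
poch q x (suc n) = poch q x n * (1ℚ ℚ.- x * pow q n)

Partition : Set
Partition = List ℕ

IsPartition : Partition → Set
IsPartition λ′ = Linked ℕ._≥_ λ′ × All (0 <_) λ′

-- λ_i with 0-based index i (λ_{i+1} in the paper's 1-based notation),
-- 0 beyond the length.
part : Partition → ℕ → ℕ
part []       _       = 0
part (a ∷ _)  zero    = a
part (_ ∷ as) (suc i) = part as i

size : Partition → ℕ
size = sum

nfun : Partition → ℕ
nfun λ′ = sum (map (λ a → a C 2) λ′)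

pochP : ℚ → ℚ → Partition → ℚ
pochP q x []            = 1ℚ
pochP q x (a ∷ [])      = poch q x a
pochP q x (a ∷ b ∷ as)  = poch q x (a ∸ b) * pochP q x (b ∷ as)

qbinP : ℚ → ℕ → Partition → ℚ
qbinP q n λ′ =
  if n <ᵇ part λ′ 0 then 0ℚ
  else (poch q q n /? (poch q q (n ∸ part λ′ 0) * pochP q q λ′))

qbin : ℚ → ℕ → ℕ → ℚ
qbin q n m =
  if n <ᵇ m then 0ℚ
  else (poch q q n /? (poch q q (n ∸ m) * poch q q m))

-- λ/μ is an m-horizontal strip: μ ⊆ λ, |λ/μ| = m, and at most one cell
-- of λ/μ in each column (rows i, column j ≥ 1; cell (i,j) ∈ λ/μ iff μ_i < j ≤ λ_i).
IsHorizontalStrip : ℕ → Partition → Partition → Set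
IsHorizontalStrip m λ′ μ =
  (∀ i → part μ i ≤ part λ′ i) ×
  (size λ′ ≡ size μ ℕ.+ m) ×
  (∀ i i′ j → part μ i < j → j ≤ part λ′ i →
              part μ i′ < j → j ≤ part λ′ i′ → i ≡ i′)

-- ∏_{i ≥ 1} [λ_i - λ_{i+1} over λ_i - μ_i]  (factors beyond ℓ(λ) equal 1)
stripProd : ℚ → Partition → Partition → ℚ
stripProd q λ′ μ =
  List.foldr _*_ 1ℚ
    (map (λ i → qbin q (part λ′ i ∸ part λ′ (suc i)) (part λ′ i ∸ part μ i))
         (upTo (length λ′)))

rhsSum : ℚ → ℕ → Partition → List Partition → ℚ
rhsSum q n μ L =
  List.foldr ℚ._+_ 0ℚ
    (map (λ λ′ → pow q (nfun λ′) * qbinP q n λ′ * stripProd q λ′ μ) L)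

-- A horizontal strip λ/μ is the same thing as an interlacing μᵢ ≤ λᵢ, λᵢ₊₁ ≤ μᵢ.  Hence the strips
-- over μ = (y , μ′) arise by growing the first row by a and putting a strip of size b = m − a on top
-- of μ′ whose first row is at most y.  The revision identities [N,c][N−c,a] = [N,a][N−a,c] and
-- [n,y+a][y+a,a] = [n,y][n−y,a] turn the summand for λ = (y + a , ν) into
-- q^{C(y+a,2)} [n,y] [n−y,a] times the summand for ν over μ′, so by induction on the length of μ the
-- sum over b collapses and what is left is the q-Vandermonde identity
--   Σ_{a+b=m} q^{C(y+a,2)+C(b,2)} [x,a] [y,b] = q^{C(m,2)+C(y,2)} [x+y,m]
-- with x = n − y.  The q-binomials are defined by the Pascal recurrence; their quotient form
-- (q;q)_n / ((q;q)_{n−k} (q;q)_k), which needs q ≠ ±1, only enters through the revision identities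
-- and through the identification with the quotient definitions of [n,m] and [n,λ].
module Submission where

open import Defs
open import Data.Bool using (true; false)
open import Data.Empty using (⊥; ⊥-elim)
open import Data.List as List using (List; []; _∷_; _++_; concatMap; drop; length; applyUpTo)
open import Data.List.Membership.Propositional using (_∈_; find; lose)
open import Data.List.Membership.Propositional.Properties
  using (∈-map⁺; ∈-map⁻; ∈-concatMap⁺; ∈-concatMap⁻)
open import Data.List.Membership.Propositional.Properties.WithK using (unique∧set⇒bag)
open import Data.List.Properties using (map-applyUpTo)
open import Data.List.Relation.Binary.BagAndSetEquality using (∼bag⇒↭)
open import Data.List.Relation.Binary.Permutation.Propositional as ↭ using (_↭_)
import Data.List.Relation.Unary.All as All
import Data.List.Relation.Unary.All.Properties as All
open import Data.List.Relation.Unary.AllPairs using ([]; _∷_)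
open import Data.List.Relation.Unary.Any using (here; there)
open import Data.List.Relation.Unary.Linked as Linked using (Linked; []; [-]; _∷_)
open import Data.List.Relation.Unary.Unique.Propositional using (Unique)
import Data.List.Relation.Unary.Unique.Propositional.Properties as Unique
open import Data.Nat as ℕ using (ℕ; zero; suc; _∸_; _≤_; _<_; _<ᵇ_; z≤n; s≤s)
open import Data.Nat.Combinatorics using (_C_; nCk+nC[k+1]≡[n+1]C[k+1]; nC1≡n)
import Data.Nat.Properties as ℕ
open import Data.Nat.Tactic.RingSolver using () renaming (solve-∀ to ℕ-solve-∀)
open import Data.Product using (_×_; _,_; proj₁; proj₂; map₁)
open import Data.Rational as ℚ using (ℚ; 0ℚ; 1ℚ; -_; _*_; _+_; _-_; 1/_; ∣_∣; NonNegative)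
open import Data.Rational.Properties as ℚ
  using (*-identityˡ; *-identityʳ; *-assoc; *-comm; *-zeroˡ; *-zeroʳ; *-inverseˡ; *-inverseʳ)
open import Algebra.Bundles using (CommutativeMonoid)
open import Algebra.Properties.CommutativeSemigroup
  (CommutativeMonoid.commutativeSemigroup ℚ.+-0-commutativeMonoid) using (interchange; x∙yz≈y∙xz)
open import Data.Rational.Solver using (module +-*-Solver)
open +-*-Solver using (solve; _:=_; _:+_; _:*_; _:-_; con)
open import Data.Sum using (inj₁; inj₂)
open import Function using (case_of_; _∘_)
open import Function.Bundles using (_⇔_; mk⇔; Equivalence)
open import Relation.Binary.Definitions using (tri<; tri≈; tri>)
open import Relation.Binary.PropositionalEquality
open import Relation.Nullary using (Dec; yes; no; ¬_)
open import Relation.Nullary.Reflects using (ofʸ; ofⁿ)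

private variable
  A B : Set

pow-distribˡ-+-* : ∀ q a b → pow q (a ℕ.+ b) ≡ pow q a * pow q b
pow-distribˡ-+-* q zero    b = sym (*-identityˡ (pow q b))
pow-distribˡ-+-* q (suc a) b =
  trans (cong (q *_) (pow-distribˡ-+-* q a b)) (sym (*-assoc q (pow q a) (pow q b)))

∣pow∣≡pow∣∣ : ∀ q k → ∣ pow q k ∣ ≡ pow ∣ q ∣ k
∣pow∣≡pow∣∣ q zero    = refl
∣pow∣≡pow∣∣ q (suc k) =
  trans (ℚ.∣p*q∣≡∣p∣*∣q∣ q (pow q k)) (cong (∣ q ∣ *_) (∣pow∣≡pow∣∣ q k))

module _ (r : ℚ) .{{_ : NonNegative r}} where

  pow-≤1 : r ℚ.≤ 1ℚ → ∀ k → pow r k ℚ.≤ 1ℚ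
  pow-≤1 r≤1 zero    = ℚ.≤-refl
  pow-≤1 r≤1 (suc k) =
    ℚ.≤-trans (ℚ.*-monoˡ-≤-nonNeg r (pow-≤1 r≤1 k))
              (ℚ.≤-trans (ℚ.≤-reflexive (*-identityʳ r)) r≤1)

  pow-<1 : r ℚ.< 1ℚ → ∀ k → pow r (suc k) ℚ.< 1ℚ
  pow-<1 r<1 k = ℚ.≤-<-trans (ℚ.*-monoˡ-≤-nonNeg r (pow-≤1 (ℚ.<⇒≤ r<1) k))
                             (ℚ.≤-<-trans (ℚ.≤-reflexive (*-identityʳ r)) r<1)

  pow-≥1 : 1ℚ ℚ.≤ r → ∀ k → 1ℚ ℚ.≤ pow r k
  pow-≥1 1≤r zero    = ℚ.≤-refl
  pow-≥1 1≤r (suc k) =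
    ℚ.≤-trans 1≤r (ℚ.≤-trans (ℚ.≤-reflexive (sym (*-identityʳ r)))
                             (ℚ.*-monoˡ-≤-nonNeg r (pow-≥1 1≤r k)))

  pow->1 : 1ℚ ℚ.< r → ∀ k → 1ℚ ℚ.< pow r (suc k)
  pow->1 1<r k = ℚ.<-≤-trans 1<r (ℚ.≤-trans (ℚ.≤-reflexive (sym (*-identityʳ r)))
                                            (ℚ.*-monoˡ-≤-nonNeg r (pow-≥1 (ℚ.<⇒≤ 1<r) k)))

  pow[1+k]≡1⇒≡1 : ∀ k → pow r (suc k) ≡ 1ℚ → r ≡ 1ℚ
  pow[1+k]≡1⇒≡1 k r^[1+k]≡1 with ℚ.<-cmp r 1ℚ
  ... | tri< r<1 _ _ = ⊥-elim (ℚ.<-irrefl r^[1+k]≡1 (pow-<1 r<1 k))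
  ... | tri≈ _ r≡1 _ = r≡1
  ... | tri> _ _ r>1 = ⊥-elim (ℚ.<-irrefl (sym r^[1+k]≡1) (pow->1 r>1 k))

pow[1+k]≢1 : ∀ {q} → q ≢ 1ℚ → q ≢ - 1ℚ → ∀ k → pow q (suc k) ≢ 1ℚ
pow[1+k]≢1 {q} q≢1 q≢-1 k q^[1+k]≡1 =
  case ℚ.∣p∣≡p∨∣p∣≡-p q of λ where
    (inj₁ ∣q∣≡q)  → q≢1 (trans (sym ∣q∣≡q) ∣q∣≡1)
    (inj₂ ∣q∣≡-q) → q≢-1 (ℚ.neg-injective (trans (sym ∣q∣≡-q) ∣q∣≡1))
  where
  ∣q∣≡1 : ∣ q ∣ ≡ 1ℚ
  ∣q∣≡1 = pow[1+k]≡1⇒≡1 ∣ q ∣ {{ℚ.∣-∣-nonNeg q}} k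
            (trans (sym (∣pow∣≡pow∣∣ q (suc k))) (cong ∣_∣ q^[1+k]≡1))

1-p≢0 : ∀ {p} → p ≢ 1ℚ → 1ℚ - p ≢ 0ℚ
1-p≢0 {p} p≢1 1-p≡0 = p≢1 (begin
  p               ≡⟨ p≡1-[1-p] p ⟩
  1ℚ - (1ℚ - p)   ≡⟨ cong (λ x → 1ℚ - x) 1-p≡0 ⟩
  1ℚ - 0ℚ         ≡⟨⟩
  1ℚ              ∎)
  where
  open ≡-Reasoning
  p≡1-[1-p] : ∀ p → p ≡ 1ℚ - (1ℚ - p)
  p≡1-[1-p] = solve 1 (λ p → p := con 1ℚ :- (con 1ℚ :- p)) refl

*-≢0 : ∀ {p r} → p ≢ 0ℚ → r ≢ 0ℚ → p * r ≢ 0ℚ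
*-≢0 {p} {r} p≢0 r≢0 pr≡0 = r≢0 (begin
  r              ≡⟨ sym (*-identityˡ r) ⟩
  1ℚ * r         ≡⟨ cong (_* r) (sym (*-inverseˡ p)) ⟩
  (1/ p * p) * r ≡⟨ *-assoc (1/ p) p r ⟩
  1/ p * (p * r) ≡⟨ cong (1/ p *_) pr≡0 ⟩
  1/ p * 0ℚ      ≡⟨ *-zeroʳ (1/ p) ⟩
  0ℚ             ∎)
  where
  open ≡-Reasoning
  instance _ = ℚ.≢-nonZero p≢0

*-cancelʳ-≢0 : ∀ {p s r} → r ≢ 0ℚ → p * r ≡ s * r → p ≡ s
*-cancelʳ-≢0 {p} {s} {r} r≢0 pr≡sr = begin
  p                ≡⟨ sym (*-identityʳ p) ⟩
  p * 1ℚ           ≡⟨ cong (p *_) (sym (*-inverseʳ r)) ⟩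
  p * (r * 1/ r)   ≡⟨ sym (*-assoc p r (1/ r)) ⟩
  p * r * 1/ r     ≡⟨ cong (_* 1/ r) pr≡sr ⟩
  s * r * 1/ r     ≡⟨ *-assoc s r (1/ r) ⟩
  s * (r * 1/ r)   ≡⟨ cong (s *_) (*-inverseʳ r) ⟩
  s * 1ℚ           ≡⟨ *-identityʳ s ⟩
  s                ∎
  where
  open ≡-Reasoning
  instance _ = ℚ.≢-nonZero r≢0

/?-≡ : ∀ {p s r} → r ≢ 0ℚ → p ≡ s * r → p /? r ≡ s
/?-≡ {p} {s} {r} r≢0 p≡sr with r ℚ.≟ 0ℚ
... | yes r≡0 = ⊥-elim (r≢0 r≡0)
... | no  _   = *-cancelʳ-≢0 r≢0 (begin
  p * 1/ r * r   ≡⟨ *-assoc p (1/ r) r ⟩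
  p * (1/ r * r) ≡⟨ cong (p *_) (*-inverseˡ r) ⟩
  p * 1ℚ         ≡⟨ *-identityʳ p ⟩
  p              ≡⟨ p≡sr ⟩
  s * r          ∎)
  where
  open ≡-Reasoning
  instance _ = ℚ.≢-nonZero r≢0

∑ : List A → (A → ℚ) → ℚ
∑ xs f = List.foldr _+_ 0ℚ (List.map f xs)

∑-++ : ∀ (xs ys : List A) f → ∑ (xs ++ ys) f ≡ ∑ xs f + ∑ ys f
∑-++ []       ys f = sym (ℚ.+-identityˡ (∑ ys f))
∑-++ (x ∷ xs) ys f =
  trans (cong (f x +_) (∑-++ xs ys f)) (sym (ℚ.+-assoc (f x) (∑ xs f) (∑ ys f)))

∑-concatMap : ∀ (g : A → List B) xs f → ∑ (concatMap g xs) f ≡ ∑ xs (λ x → ∑ (g x) f)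
∑-concatMap g []       f = refl
∑-concatMap g (x ∷ xs) f =
  trans (∑-++ (g x) (concatMap g xs) f) (cong (∑ (g x) f +_) (∑-concatMap g xs f))

∑-map : ∀ (g : A → B) xs f → ∑ (List.map g xs) f ≡ ∑ xs (λ x → f (g x))
∑-map g []       f = refl
∑-map g (x ∷ xs) f = cong (f (g x) +_) (∑-map g xs f)

∑-*ˡ : ∀ c (xs : List A) f → ∑ xs (λ x → c * f x) ≡ c * ∑ xs f
∑-*ˡ c []       f = sym (*-zeroʳ c)
∑-*ˡ c (x ∷ xs) f =
  trans (cong (c * f x +_) (∑-*ˡ c xs f)) (sym (ℚ.*-distribˡ-+ c (f x) (∑ xs f)))

∑-+ : ∀ (xs : List A) f g → ∑ xs (λ x → f x + g x) ≡ ∑ xs f + ∑ xs g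
∑-+ []       f g = refl
∑-+ (x ∷ xs) f g = trans (cong (f x + g x +_) (∑-+ xs f g)) (interchange (f x) (g x) (∑ xs f) (∑ xs g))

∑-cong : ∀ (xs : List A) {f g} → (∀ {x} → x ∈ xs → f x ≡ g x) → ∑ xs f ≡ ∑ xs g
∑-cong []       f≗g = refl
∑-cong (x ∷ xs) f≗g = cong₂ _+_ (f≗g (here refl)) (∑-cong xs (f≗g ∘ there))

∑-0 : ∀ (xs : List A) → ∑ xs (λ _ → 0ℚ) ≡ 0ℚ
∑-0 []       = refl
∑-0 (x ∷ xs) = cong (0ℚ +_) (∑-0 xs)

∑-↭ : ∀ {xs ys : List A} f → xs ↭ ys → ∑ xs f ≡ ∑ ys f
∑-↭ f ↭.refl                  = refl
∑-↭ f (↭.prep x xs↭ys)        = cong (f x +_) (∑-↭ f xs↭ys)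
∑-↭ f (↭.swap {ys = ys} x y xs↭ys) =
  trans (cong (λ s → f x + (f y + s)) (∑-↭ f xs↭ys)) (x∙yz≈y∙xz (f x) (f y) (∑ ys f))
∑-↭ f (↭.trans xs↭ys ys↭zs)   = trans (∑-↭ f xs↭ys) (∑-↭ f ys↭zs)

antidiagonal : ℕ → List (ℕ × ℕ)
antidiagonal zero    = (0 , 0) ∷ []
antidiagonal (suc k) = (0 , suc k) ∷ List.map (map₁ suc) (antidiagonal k)

∑-antidiagonal-suc : ∀ k f →
  ∑ (antidiagonal (suc k)) f ≡ f (0 , suc k) + ∑ (antidiagonal k) (f ∘ map₁ suc)
∑-antidiagonal-suc k f = cong (f (0 , suc k) +_) (∑-map (map₁ suc) (antidiagonal k) f)

∈-antidiagonal⁻ : ∀ m {a b} → (a , b) ∈ antidiagonal m → a ℕ.+ b ≡ m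
∈-antidiagonal⁻ zero    (here refl) = refl
∈-antidiagonal⁻ (suc k) (here refl) = refl
∈-antidiagonal⁻ (suc k) (there p∈) with ∈-map⁻ (map₁ suc) p∈
... | (a , b) , ab∈ , refl = cong suc (∈-antidiagonal⁻ k ab∈)

∈-antidiagonal⁺ : ∀ a b → (a , b) ∈ antidiagonal (a ℕ.+ b)
∈-antidiagonal⁺ zero    zero    = here refl
∈-antidiagonal⁺ zero    (suc b) = here refl
∈-antidiagonal⁺ (suc a) b       = there (∈-map⁺ (map₁ suc) (∈-antidiagonal⁺ a b))

antidiagonal-unique : ∀ m → Unique (antidiagonal m)
antidiagonal-unique zero    = All.[] ∷ []
antidiagonal-unique (suc k) =
  All.map⁺ (All.tabulate (λ _ ())) ∷ Unique.map⁺ map₁-suc-injective (antidiagonal-unique k)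
  where
  map₁-suc-injective : ∀ {p p′ : ℕ × ℕ} → map₁ suc p ≡ map₁ suc p′ → p ≡ p′
  map₁-suc-injective refl = refl

-- Partitions and horizontal strips

m+n≡o⇒o∸m≡n : ∀ m {n o} → m ℕ.+ n ≡ o → o ∸ m ≡ n
m+n≡o⇒o∸m≡n m {n} m+n≡o = trans (cong (_∸ m) (sym m+n≡o)) (ℕ.m+n∸m≡n m n)

part-drop : ∀ ν i → part (drop 1 ν) i ≡ part ν (suc i)
part-drop []      i = refl
part-drop (_ ∷ _) i = refl

size-drop : ∀ ν → size ν ≡ part ν 0 ℕ.+ size (drop 1 ν)
size-drop []      = refl
size-drop (_ ∷ _) = refl

size-mono : ∀ μ ν → (∀ i → part μ i ≤ part ν i) → size μ ≤ size ν
size-mono []      ν μ⊆ν = z≤n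
size-mono (y ∷ μ) ν μ⊆ν = subst (y ℕ.+ size μ ≤_) (sym (size-drop ν))
  (ℕ.+-mono-≤ (μ⊆ν 0) (size-mono μ (drop 1 ν) tail⊆))
  where
  tail⊆ : ∀ i → part μ i ≤ part (drop 1 ν) i
  tail⊆ i = subst (part μ i ≤_) (sym (part-drop ν i)) (μ⊆ν (suc i))

head-≤ : ∀ {y ν} → Linked ℕ._≥_ (y ∷ ν) → part ν 0 ≤ y
head-≤ [-]       = z≤n
head-≤ (y≥z ∷ _) = y≥z

part-anti : ∀ {ν} → Linked ℕ._≥_ ν → ∀ {i j} → i ≤ j → part ν j ≤ part ν i
part-anti {[]}    _  _                         = z≤n
part-anti {_ ∷ _} _  {zero}  {zero}  _         = ℕ.≤-refl
part-anti {_ ∷ _} ν↘ {zero}  {suc j} _         =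
  ℕ.≤-trans (part-anti (Linked.tail ν↘) {0} {j} z≤n) (head-≤ ν↘)
part-anti {_ ∷ _} ν↘ {suc i} {suc j} (s≤s i≤j) = part-anti (Linked.tail ν↘) i≤j

∷-isPartition : ∀ {x ν} → IsPartition ν → part ν 0 ≤ x → 0 < x → IsPartition (x ∷ ν)
∷-isPartition {ν = []}    (ν↘ , ν⁺) _   0<x = [-] , 0<x All.∷ ν⁺
∷-isPartition {ν = _ ∷ _} (ν↘ , ν⁺) c≤x 0<x = c≤x ∷ ν↘ , 0<x All.∷ ν⁺

record IsInterlacingStrip (m : ℕ) (λ′ μ : Partition) : Set where
  constructor interlacingStrip
  field
    contains   : ∀ i → part μ i ≤ part λ′ i
    size≡      : size λ′ ≡ size μ ℕ.+ m
    interlaces : ∀ i → part λ′ (suc i) ≤ part μ i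

interlacing-column : ∀ {λ′} μ → Linked ℕ._≥_ λ′ → (∀ i → part λ′ (suc i) ≤ part μ i) →
                     ∀ {i i′ j} → i < i′ → part μ i < j → j ≤ part λ′ i′ → ⊥
interlacing-column μ λ′↘ interlace {i} i<i′ μᵢ<j j≤λ′ᵢ′ =
  ℕ.<-irrefl refl (ℕ.≤-<-trans j≤μᵢ μᵢ<j)
  where j≤μᵢ = ℕ.≤-trans j≤λ′ᵢ′ (ℕ.≤-trans (part-anti λ′↘ i<i′) (interlace i))

interlacing⇒horizontalStrip : ∀ {m λ′ μ} → Linked ℕ._≥_ λ′ → IsInterlacingStrip m λ′ μ →
                              IsHorizontalStrip m λ′ μ
interlacing⇒horizontalStrip {λ′ = λ′} {μ} λ′↘ (interlacingStrip μ⊆λ′ size≡ interlace) =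
  μ⊆λ′ , size≡ , one-per-column
  where
  one-per-column : ∀ i i′ j → part μ i < j → j ≤ part λ′ i →
                   part μ i′ < j → j ≤ part λ′ i′ → i ≡ i′
  one-per-column i i′ j μᵢ<j j≤λ′ᵢ μᵢ′<j j≤λ′ᵢ′ with ℕ.<-cmp i i′
  ... | tri< i<i′ _ _ = ⊥-elim (interlacing-column μ λ′↘ interlace i<i′ μᵢ<j j≤λ′ᵢ′)
  ... | tri≈ _ i≡i′ _ = i≡i′
  ... | tri> _ _ i′<i = ⊥-elim (interlacing-column μ λ′↘ interlace i′<i μᵢ′<j j≤λ′ᵢ)

-- If λ′ᵢ₊₁ > μᵢ, the last cell of row i+1 shares its column with a cell of row i.
horizontalStrip⇒interlacing : ∀ {m λ′ μ} → Linked ℕ._≥_ λ′ → Linked ℕ._≥_ μ →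
                              IsHorizontalStrip m λ′ μ → IsInterlacingStrip m λ′ μ
horizontalStrip⇒interlacing {λ′ = λ′} {μ} λ′↘ μ↘ (μ⊆λ′ , size≡ , one-per-column) =
  interlacingStrip μ⊆λ′ size≡ interlace
  where
  interlace : ∀ i → part λ′ (suc i) ≤ part μ i
  interlace i with part λ′ (suc i) ℕ.≤? part μ i
  ... | yes λ′ᵢ₊₁≤μᵢ = λ′ᵢ₊₁≤μᵢ
  ... | no  λ′ᵢ₊₁≰μᵢ = ⊥-elim (ℕ.1+n≢n (sym (one-per-column i (suc i) (part λ′ (suc i))
          μᵢ<λ′ᵢ₊₁ (part-anti λ′↘ (ℕ.n≤1+n i)) μᵢ₊₁<λ′ᵢ₊₁ ℕ.≤-refl)))
    where
    μᵢ<λ′ᵢ₊₁   = ℕ.≰⇒> λ′ᵢ₊₁≰μᵢ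
    μᵢ₊₁<λ′ᵢ₊₁ = ℕ.≤-<-trans (part-anti μ↘ (ℕ.n≤1+n i)) μᵢ<λ′ᵢ₊₁

interlacing-head : ∀ {m λ′ μ} → IsInterlacingStrip m λ′ μ → part λ′ 0 ≤ part μ 0 ℕ.+ m
interlacing-head {m} {λ′} {μ} (interlacingStrip μ⊆λ′ size≡ _) =
  ℕ.+-cancelʳ-≤ (size (drop 1 μ)) (part λ′ 0) (part μ 0 ℕ.+ m) (begin
    part λ′ 0 ℕ.+ size (drop 1 μ)       ≤⟨ ℕ.+-monoʳ-≤ (part λ′ 0) (size-mono μ-tail λ′-tail tail⊆) ⟩
    part λ′ 0 ℕ.+ size (drop 1 λ′)      ≡⟨ size-drop λ′ ⟨
    size λ′                             ≡⟨ size≡ ⟩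
    size μ ℕ.+ m                        ≡⟨ cong (ℕ._+ m) (size-drop μ) ⟩
    part μ 0 ℕ.+ size (drop 1 μ) ℕ.+ m  ≡⟨ right-comm (part μ 0) (size (drop 1 μ)) m ⟩
    part μ 0 ℕ.+ m ℕ.+ size (drop 1 μ)  ∎)
  where
  open ℕ.≤-Reasoning
  right-comm : ∀ a b c → a ℕ.+ b ℕ.+ c ≡ a ℕ.+ c ℕ.+ b
  right-comm = ℕ-solve-∀
  μ-tail  = drop 1 μ
  λ′-tail = drop 1 λ′
  tail⊆ : ∀ i → part μ-tail i ≤ part λ′-tail i
  tail⊆ i = subst₂ _≤_ (sym (part-drop μ i)) (sym (part-drop λ′ i)) (μ⊆λ′ (suc i))

interlacing-cons : ∀ {a b y ν μ} → IsInterlacingStrip b ν μ → part ν 0 ≤ y →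
                   IsInterlacingStrip (a ℕ.+ b) ((y ℕ.+ a) ∷ ν) (y ∷ μ)
interlacing-cons {a} {b} {y} {ν} {μ} (interlacingStrip μ⊆ν size≡ interlace) ν₀≤y =
  interlacingStrip μ⊆ size≡′ interlace′
  where
  μ⊆ : ∀ i → part (y ∷ μ) i ≤ part ((y ℕ.+ a) ∷ ν) i
  μ⊆ zero    = ℕ.m≤m+n y a
  μ⊆ (suc i) = μ⊆ν i
  interlace′ : ∀ i → part ((y ℕ.+ a) ∷ ν) (suc i) ≤ part (y ∷ μ) i
  interlace′ zero    = ν₀≤y
  interlace′ (suc i) = interlace i
  shuffle : ∀ y a s b → y ℕ.+ a ℕ.+ (s ℕ.+ b) ≡ y ℕ.+ s ℕ.+ (a ℕ.+ b)
  shuffle = ℕ-solve-∀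
  size≡′ : y ℕ.+ a ℕ.+ size ν ≡ y ℕ.+ size μ ℕ.+ (a ℕ.+ b)
  size≡′ = trans (cong (y ℕ.+ a ℕ.+_) size≡) (shuffle y a (size μ) b)

interlacing-uncons : ∀ {m x y ν μ} → IsInterlacingStrip m (x ∷ ν) (y ∷ μ) →
                     let a = x ∸ y; b = size ν ∸ size μ in
                     IsInterlacingStrip b ν μ × part ν 0 ≤ y × y ℕ.+ a ≡ x × a ℕ.+ b ≡ m
interlacing-uncons {m} {x} {y} {ν} {μ} (interlacingStrip μ⊆ size≡ interlace) =
  interlacingStrip (μ⊆ ∘ suc) (sym sμ+b≡sν) (interlace ∘ suc) , interlace 0 , y+a≡x , a+b≡m
  where
  a = x ∸ y
  b = size ν ∸ size μ
  y+a≡x : y ℕ.+ a ≡ x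
  y+a≡x = ℕ.m+[n∸m]≡n (μ⊆ 0)
  sμ+b≡sν : size μ ℕ.+ b ≡ size ν
  sμ+b≡sν = ℕ.m+[n∸m]≡n (size-mono μ ν (μ⊆ ∘ suc))
  shuffle : ∀ y a s b → y ℕ.+ a ℕ.+ (s ℕ.+ b) ≡ y ℕ.+ s ℕ.+ (a ℕ.+ b)
  shuffle = ℕ-solve-∀
  a+b≡m : a ℕ.+ b ≡ m
  a+b≡m = ℕ.+-cancelˡ-≡ (y ℕ.+ size μ) (a ℕ.+ b) m (begin
    y ℕ.+ size μ ℕ.+ (a ℕ.+ b)   ≡⟨ shuffle y a (size μ) b ⟨
    y ℕ.+ a ℕ.+ (size μ ℕ.+ b)   ≡⟨ cong₂ ℕ._+_ y+a≡x sμ+b≡sν ⟩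
    x ℕ.+ size ν                 ≡⟨ size≡ ⟩
    y ℕ.+ size μ ℕ.+ m           ∎)
    where open ≡-Reasoning

-- Enumeration of the strips

guard : {P : Set} → Dec P → List A → List A
guard (yes _) xs = xs
guard (no  _) _  = []

∈-guard⁺ : ∀ {P : Set} {x : A} {xs} (P? : Dec P) → P → x ∈ xs → x ∈ guard P? xs
∈-guard⁺ (yes _) _ x∈xs = x∈xs
∈-guard⁺ (no ¬p) p _    = ⊥-elim (¬p p)

∈-guard⁻ : ∀ {P : Set} {x : A} {xs} (P? : Dec P) → x ∈ guard P? xs → P × x ∈ xs
∈-guard⁻ (yes p) x∈xs = p , x∈xs

Unique-concatMap⁺ : ∀ (g : A → List B) {xs} → Unique xs → (∀ x → Unique (g x)) →
                    (∀ {x x′ z} → x ∈ xs → x′ ∈ xs → z ∈ g x → z ∈ g x′ → x ≡ x′) →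
                    Unique (concatMap g xs)
Unique-concatMap⁺ g {[]}     _             _  _          = []
Unique-concatMap⁺ g {x ∷ xs} (x∉xs ∷ xs!) g! overlap⇒≡ =
  Unique.++⁺ (g! x) (Unique-concatMap⁺ g xs! g! (λ x∈ x′∈ → overlap⇒≡ (there x∈) (there x′∈)))
             disjoint
  where
  disjoint : ∀ {z} → ¬ (z ∈ g x × z ∈ concatMap g xs)
  disjoint (z∈gx , z∈rest) with find (∈-concatMap⁻ g {xs = xs} z∈rest)
  ... | x′ , x′∈xs , z∈gx′ =
    All.lookup x∉xs x′∈xs (overlap⇒≡ (here refl) (there x′∈xs) z∈gx z∈gx′)

-- strips B m μ lists the interlacing m-strips over μ with first row at most B; on the tail the
-- bound becomes μ₁, which is the interlacing condition λ′₂ ≤ μ₁.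
strips : ℕ → ℕ → Partition → List Partition
stripsSplit : ℕ → ℕ → Partition → ℕ × ℕ → List Partition

strips B m       (y ∷ μ) = concatMap (stripsSplit B y μ) (antidiagonal m)
strips B zero    []      = [] ∷ []
strips B (suc k) []      = guard (suc k ℕ.≤? B) ((suc k ∷ []) ∷ [])

stripsSplit B y μ (a , b) = guard (y ℕ.+ a ℕ.≤? B) (List.map ((y ℕ.+ a) ∷_) (strips y b μ))

∈-strips⁻ : ∀ B m μ {λ′} → IsPartition μ → λ′ ∈ strips B m μ →
            IsPartition λ′ × IsInterlacingStrip m λ′ μ × part λ′ 0 ≤ B
∈-strips⁻ B zero    [] _ (here refl) =
  ([] , All.[]) , interlacingStrip (λ _ → z≤n) refl (λ _ → z≤n) , z≤n
∈-strips⁻ B (suc k) [] _ λ′∈ with ∈-guard⁻ (suc k ℕ.≤? B) λ′∈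
... | 1+k≤B , here refl =
  ([-] , s≤s z≤n All.∷ All.[]) ,
  interlacingStrip (λ _ → z≤n) (ℕ.+-identityʳ (suc k)) (λ _ → z≤n) ,
  1+k≤B
∈-strips⁻ B m (y ∷ μ) (μ↘ , 0<y All.∷ μ⁺) λ′∈
  with find (∈-concatMap⁻ (stripsSplit B y μ) {xs = antidiagonal m} λ′∈)
... | (a , b) , ab∈ , λ′∈′ with ∈-guard⁻ (y ℕ.+ a ℕ.≤? B) λ′∈′
... | y+a≤B , λ′∈″ with ∈-map⁻ ((y ℕ.+ a) ∷_) λ′∈″
... | ν , ν∈ , refl with ∈-strips⁻ y b μ (Linked.tail μ↘ , μ⁺) ν∈
... | ν-part , ν-strip , ν₀≤y =
  ∷-isPartition ν-part (ℕ.≤-trans ν₀≤y (ℕ.m≤m+n y a)) (ℕ.<-≤-trans 0<y (ℕ.m≤m+n y a)) ,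
  subst (λ m → IsInterlacingStrip m ((y ℕ.+ a) ∷ ν) (y ∷ μ)) (∈-antidiagonal⁻ m ab∈)
        (interlacing-cons ν-strip ν₀≤y) ,
  y+a≤B

∈-strips⁺ : ∀ B m μ {λ′} → IsPartition μ → IsPartition λ′ →
            IsInterlacingStrip m λ′ μ → part λ′ 0 ≤ B → λ′ ∈ strips B m μ
∈-strips⁺ B zero    [] {[]} _ _ _ _ = here refl
∈-strips⁺ B (suc k) [] {[]} _ _ (interlacingStrip _ () _) _
∈-strips⁺ B m [] {suc x ∷ []} _ _ (interlacingStrip _ 1+x+0≡m _) 1+x≤B
  with refl ← trans (cong suc (sym (ℕ.+-identityʳ x))) 1+x+0≡m =
  ∈-guard⁺ (suc x ℕ.≤? B) 1+x≤B (here refl)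
∈-strips⁺ B m [] {_ ∷ _ ∷ _} _ (_ , _ All.∷ 0<c All.∷ _) (interlacingStrip _ _ interlace) _ =
  ⊥-elim (ℕ.<-irrefl refl (ℕ.<-≤-trans 0<c (interlace 0)))
∈-strips⁺ B m (y ∷ μ) {[]} (_ , 0<y All.∷ _) _ (interlacingStrip μ⊆ _ _) _ =
  ⊥-elim (ℕ.<-irrefl refl (ℕ.<-≤-trans 0<y (μ⊆ 0)))
∈-strips⁺ B m (y ∷ μ) {x ∷ ν} (μ↘ , _ All.∷ μ⁺) (ν↘ , _ All.∷ ν⁺) strip x≤B
  with interlacing-uncons strip
... | ν-strip , ν₀≤y , y+a≡x , a+b≡m =
  ∈-concatMap⁺ (stripsSplit B y μ) {xs = antidiagonal m}
    (lose ab∈ (subst (_∈ stripsSplit B y μ (a , b)) (cong (_∷ ν) y+a≡x) y+a∷ν∈))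
  where
  a = x ∸ y
  b = size ν ∸ size μ
  ab∈ : (a , b) ∈ antidiagonal m
  ab∈ = subst (λ m → (a , b) ∈ antidiagonal m) a+b≡m (∈-antidiagonal⁺ a b)
  ν∈ : ν ∈ strips y b μ
  ν∈ = ∈-strips⁺ y b μ (Linked.tail μ↘ , μ⁺) (Linked.tail ν↘ , ν⁺) ν-strip ν₀≤y
  y+a∷ν∈ : (y ℕ.+ a) ∷ ν ∈ stripsSplit B y μ (a , b)
  y+a∷ν∈ =
    ∈-guard⁺ (y ℕ.+ a ℕ.≤? B) (subst (_≤ B) (sym y+a≡x) x≤B) (∈-map⁺ ((y ℕ.+ a) ∷_) ν∈)

∈-stripsSplit-head : ∀ B y μ a {b λ′} → λ′ ∈ stripsSplit B y μ (a , b) → part λ′ 0 ≡ y ℕ.+ a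
∈-stripsSplit-head B y μ a λ′∈
  with ∈-map⁻ ((y ℕ.+ a) ∷_) (proj₂ (∈-guard⁻ (y ℕ.+ a ℕ.≤? B) λ′∈))
... | _ , _ , refl = refl

strips-unique : ∀ B m μ → Unique (strips B m μ)
strips-unique B m (y ∷ μ) =
  Unique-concatMap⁺ (stripsSplit B y μ) (antidiagonal-unique m) split-unique same-split
  where
  split-unique : ∀ p → Unique (stripsSplit B y μ p)
  split-unique (a , b) with y ℕ.+ a ℕ.≤? B
  ... | yes _ = Unique.map⁺ (λ { refl → refl }) (strips-unique y b μ)
  ... | no  _ = []
  same-split : ∀ {p p′ λ′} → p ∈ antidiagonal m → p′ ∈ antidiagonal m →
               λ′ ∈ stripsSplit B y μ p → λ′ ∈ stripsSplit B y μ p′ → p ≡ p′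
  same-split {a , b} {a′ , b′} ab∈ a′b′∈ λ′∈ λ′∈′ = cong₂ _,_ a≡a′ b≡b′
    where
    a≡a′ = ℕ.+-cancelˡ-≡ y a a′
             (trans (sym (∈-stripsSplit-head B y μ a λ′∈)) (∈-stripsSplit-head B y μ a′ λ′∈′))
    b≡b′ = ℕ.+-cancelˡ-≡ a b b′ (trans (∈-antidiagonal⁻ m ab∈)
                                 (trans (sym (∈-antidiagonal⁻ m a′b′∈)) (cong (ℕ._+ b′) (sym a≡a′))))
strips-unique B zero    [] = All.[] ∷ []
strips-unique B (suc k) [] with suc k ℕ.≤? B
... | yes _ = All.[] ∷ []
... | no  _ = []

horizontalStrips↭strips : ∀ {n m μ L} → IsPartition μ → part μ 0 ≤ n → Unique L →
                          (∀ λ′ → (λ′ ∈ L) ⇔ (IsPartition λ′ × IsHorizontalStrip m λ′ μ)) →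
                          L ↭ strips (n ℕ.+ m) m μ
horizontalStrips↭strips {n} {m} {μ} {L} μ-part μ₀≤n L! L⇔ =
  ∼bag⇒↭ (unique∧set⇒bag L! (strips-unique (n ℕ.+ m) m μ) (mk⇔ to from))
  where
  to : ∀ {λ′} → λ′ ∈ L → λ′ ∈ strips (n ℕ.+ m) m μ
  to {λ′} λ′∈L with Equivalence.to (L⇔ λ′) λ′∈L
  ... | λ′-part , λ′-strip = ∈-strips⁺ (n ℕ.+ m) m μ μ-part λ′-part interlacing
    (ℕ.≤-trans (interlacing-head interlacing) (ℕ.+-monoˡ-≤ m μ₀≤n))
    where interlacing = horizontalStrip⇒interlacing (proj₁ λ′-part) (proj₁ μ-part) λ′-strip
  from : ∀ {λ′} → λ′ ∈ strips (n ℕ.+ m) m μ → λ′ ∈ L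
  from {λ′} λ′∈ with ∈-strips⁻ (n ℕ.+ m) m μ μ-part λ′∈
  ... | λ′-part , interlacing , _ =
    Equivalence.from (L⇔ λ′) (λ′-part , interlacing⇒horizontalStrip (proj₁ λ′-part) interlacing)

-- q-binomial coefficients

[1+n]C2≡nC2+n : ∀ n → suc n C 2 ≡ n C 2 ℕ.+ n
[1+n]C2≡nC2+n n =
  trans (sym (nCk+nC[k+1]≡[n+1]C[k+1] n 1)) (trans (cong (ℕ._+ n C 2) (nC1≡n n)) (ℕ.+-comm n (n C 2)))

module QBinomial (q : ℚ) where

  qfact : ℕ → ℚ
  qfact = poch q q

  qbinom : ℕ → ℕ → ℚ
  qbinom n       zero    = 1ℚ
  qbinom zero    (suc k) = 0ℚ
  qbinom (suc n) (suc k) = pow q (n ∸ k) * qbinom n k + qbinom n (suc k)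

  qbinomₚ : ℕ → Partition → ℚ
  qbinomₚ n []      = 1ℚ
  qbinomₚ n (a ∷ ν) = qbinom n a * qbinomₚ a ν

  stripWeight : Partition → Partition → ℚ
  stripWeight []      μ = 1ℚ
  stripWeight (a ∷ ν) μ = qbinom (a ∸ part ν 0) (a ∸ part μ 0) * stripWeight ν (drop 1 μ)

  weight : ℕ → Partition → Partition → ℚ
  weight n μ λ′ = pow q (nfun λ′) * qbinomₚ n λ′ * stripWeight λ′ μ

  qbinom-> : ∀ {n k} → n < k → qbinom n k ≡ 0ℚ
  qbinom-> {zero}  {suc k} _         = refl
  qbinom-> {suc n} {suc k} (s≤s n<k) =
    cong₂ _+_ (trans (cong (pow q (n ∸ k) *_) (qbinom-> n<k)) (*-zeroʳ (pow q (n ∸ k))))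
              (qbinom-> (ℕ.m<n⇒m<1+n n<k))

  qbinom-diag : ∀ n → qbinom n n ≡ 1ℚ
  qbinom-diag zero    = refl
  qbinom-diag (suc n) =
    cong₂ _+_ (cong₂ _*_ (cong (pow q) (ℕ.n∸n≡0 n)) (qbinom-diag n)) (qbinom-> (ℕ.n<1+n n))

  qbinom-qfact : ∀ k d → qbinom (k ℕ.+ d) k * (qfact d * qfact k) ≡ qfact (k ℕ.+ d)
  qbinom-qfact zero    d = trans (*-identityˡ (qfact d * 1ℚ)) (*-identityʳ (qfact d))
  qbinom-qfact (suc j) zero rewrite ℕ.+-identityʳ j =
    trans (cong (_* (1ℚ * qfact (suc j))) (qbinom-diag (suc j)))
          (trans (*-identityˡ (1ℚ * qfact (suc j))) (*-identityˡ (qfact (suc j))))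
  qbinom-qfact (suc j) (suc e) = begin
    (pow q (N ∸ j) * x + y) * (qfact e * (1ℚ - u) * (qfact j * (1ℚ - v)))
      ≡⟨ cong (λ t → (pow q t * x + y) * (qfact e * (1ℚ - u) * (qfact j * (1ℚ - v))))
              (ℕ.m+n∸m≡n j (suc e)) ⟩
    (u * x + y) * (qfact e * (1ℚ - u) * (qfact j * (1ℚ - v)))
      ≡⟨ regroup u v x y (qfact e) (qfact j) ⟩
    u * (1ℚ - v) * (x * (qfact (suc e) * qfact j)) + (1ℚ - u) * (y * (qfact e * qfact (suc j)))
      ≡⟨ cong₂ (λ s t → u * (1ℚ - v) * s + (1ℚ - u) * t) (qbinom-qfact j (suc e)) y-qfact ⟩
    u * (1ℚ - v) * qfact N + (1ℚ - u) * qfact N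
      ≡⟨ collect u v (qfact N) ⟩
    qfact N * (1ℚ - u * v)
      ≡⟨ cong (λ w → qfact N * (1ℚ - w)) u*v≡q^[1+N] ⟩
    qfact (suc N) ∎
    where
    open ≡-Reasoning
    N = j ℕ.+ suc e
    x = qbinom N j
    y = qbinom N (suc j)
    u = pow q (suc e)
    v = pow q (suc j)
    y-qfact : y * (qfact e * qfact (suc j)) ≡ qfact N
    y-qfact = subst (λ n → qbinom n (suc j) * (qfact e * qfact (suc j)) ≡ qfact n)
                    (sym (ℕ.+-suc j e)) (qbinom-qfact (suc j) e)
    u*v≡q^[1+N] : u * v ≡ pow q (suc N)
    u*v≡q^[1+N] = trans (sym (pow-distribˡ-+-* q (suc e) (suc j))) (cong (pow q) (ℕ.+-comm (suc e) (suc j)))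
    regroup : ∀ u v x y fe fj →
      (u * x + y) * (fe * (1ℚ - u) * (fj * (1ℚ - v))) ≡
      u * (1ℚ - v) * (x * (fe * (1ℚ - u) * fj)) + (1ℚ - u) * (y * (fe * (fj * (1ℚ - v))))
    regroup = solve 6 (λ u v x y fe fj →
      (u :* x :+ y) :* (fe :* (con 1ℚ :- u) :* (fj :* (con 1ℚ :- v))) :=
      u :* (con 1ℚ :- v) :* (x :* (fe :* (con 1ℚ :- u) :* fj)) :+
      (con 1ℚ :- u) :* (y :* (fe :* (fj :* (con 1ℚ :- v)))))
      refl
    collect : ∀ u v p → u * (1ℚ - v) * p + (1ℚ - u) * p ≡ p * (1ℚ - u * v)
    collect = solve 3 (λ u v p → u :* (con 1ℚ :- v) :* p :+ (con 1ℚ :- u) :* p := p :* (con 1ℚ :- u :* v)) refl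

  qbinom-qfact′ : ∀ {n} k d → k ℕ.+ d ≡ n → qbinom n k * (qfact d * qfact k) ≡ qfact n
  qbinom-qfact′ k d refl = qbinom-qfact k d

  -- x ∸ a truncates when a > x, which is why c must then vanish.
  pow-absorb : ∀ a x s {c} → (x < a → c ≡ 0ℚ) →
               pow q (suc a C 2 ℕ.+ s) * (pow q (x ∸ a) * c) ≡ pow q x * (pow q (a C 2 ℕ.+ s) * c)
  pow-absorb a x s {c} c≡0 with a ℕ.≤? x
  ... | no  a≰x =
    subst (λ c → pow q (suc a C 2 ℕ.+ s) * (pow q (x ∸ a) * c) ≡ pow q x * (pow q (a C 2 ℕ.+ s) * c))
          (sym (c≡0 (ℕ.≰⇒> a≰x)))
          (absorb-0 (pow q (suc a C 2 ℕ.+ s)) (pow q (x ∸ a)) (pow q x) (pow q (a C 2 ℕ.+ s)))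
    where
    absorb-0 : ∀ p r t u → p * (r * 0ℚ) ≡ t * (u * 0ℚ)
    absorb-0 = solve 4 (λ p r t u → p :* (r :* con 0ℚ) := t :* (u :* con 0ℚ)) refl
  ... | yes a≤x = begin
    pow q e₁ * (pow q (x ∸ a) * c)  ≡⟨ *-assoc (pow q e₁) (pow q (x ∸ a)) c ⟨
    pow q e₁ * pow q (x ∸ a) * c    ≡⟨ cong (_* c) (pow-distribˡ-+-* q e₁ (x ∸ a)) ⟨
    pow q (e₁ ℕ.+ (x ∸ a)) * c      ≡⟨ cong (λ t → pow q t * c) exponent ⟩
    pow q (x ℕ.+ e₀) * c            ≡⟨ cong (_* c) (pow-distribˡ-+-* q x e₀) ⟩
    pow q x * pow q e₀ * c          ≡⟨ *-assoc (pow q x) (pow q e₀) c ⟩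
    pow q x * (pow q e₀ * c)        ∎
    where
    open ≡-Reasoning
    e₁ = suc a C 2 ℕ.+ s
    e₀ = a C 2 ℕ.+ s
    shuffle : ∀ t a s d → t ℕ.+ a ℕ.+ s ℕ.+ d ≡ a ℕ.+ d ℕ.+ (t ℕ.+ s)
    shuffle = ℕ-solve-∀
    exponent : e₁ ℕ.+ (x ∸ a) ≡ x ℕ.+ e₀
    exponent = begin
      suc a C 2 ℕ.+ s ℕ.+ (x ∸ a)    ≡⟨ cong (λ t → t ℕ.+ s ℕ.+ (x ∸ a)) ([1+n]C2≡nC2+n a) ⟩
      a C 2 ℕ.+ a ℕ.+ s ℕ.+ (x ∸ a)  ≡⟨ shuffle (a C 2) a s (x ∸ a) ⟩
      a ℕ.+ (x ∸ a) ℕ.+ e₀           ≡⟨ cong (ℕ._+ e₀) (ℕ.m+[n∸m]≡n a≤x) ⟩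
      x ℕ.+ e₀                       ∎

  vandermondeTerm : ℕ → ℕ → ℕ × ℕ → ℚ
  vandermondeTerm x y (a , b) = pow q ((y ℕ.+ a) C 2 ℕ.+ b C 2) * (qbinom x a * qbinom y b)

  vandermondeTerm-pascal : ∀ x y a b →
    vandermondeTerm (suc x) y (suc a , b) ≡
      vandermondeTerm x y (suc a , b) + pow q (x ℕ.+ y) * vandermondeTerm x y (a , b)
  vandermondeTerm-pascal x y a b =
    trans (distrib E (pow q (x ∸ a)) (qbinom x a) (qbinom x (suc a)) (qbinom y b))
          (cong (vandermondeTerm x y (suc a , b) +_) shifted)
    where
    E = pow q ((y ℕ.+ suc a) C 2 ℕ.+ b C 2)
    distrib : ∀ e p u w v → e * ((p * u + w) * v) ≡ e * (w * v) + e * (p * (u * v))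
    distrib = solve 5 (λ e p u w v → e :* ((p :* u :+ w) :* v) := e :* (w :* v) :+ e :* (p :* (u :* v))) refl
    vanish : x ℕ.+ y < y ℕ.+ a → qbinom x a * qbinom y b ≡ 0ℚ
    vanish x+y<y+a =
      trans (cong (_* qbinom y b) (qbinom-> (ℕ.+-cancelˡ-< y x a (subst (_< y ℕ.+ a) (ℕ.+-comm x y) x+y<y+a))))
            (*-zeroˡ (qbinom y b))
    x+y∸[y+a]≡x∸a : x ℕ.+ y ∸ (y ℕ.+ a) ≡ x ∸ a
    x+y∸[y+a]≡x∸a = trans (cong (_∸ (y ℕ.+ a)) (ℕ.+-comm x y)) (ℕ.[m+n]∸[m+o]≡n∸o y x a)
    shifted : E * (pow q (x ∸ a) * (qbinom x a * qbinom y b)) ≡ pow q (x ℕ.+ y) * vandermondeTerm x y (a , b)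
    shifted = subst₂ (λ s t → pow q (s C 2 ℕ.+ b C 2) * (pow q t * (qbinom x a * qbinom y b)) ≡
                              pow q (x ℕ.+ y) * vandermondeTerm x y (a , b))
                     (sym (ℕ.+-suc y a)) x+y∸[y+a]≡x∸a (pow-absorb (y ℕ.+ a) (x ℕ.+ y) (b C 2) vanish)

  qbinom-vandermonde : ∀ x y m →
    ∑ (antidiagonal m) (vandermondeTerm x y) ≡ pow q (m C 2 ℕ.+ y C 2) * qbinom (x ℕ.+ y) m
  qbinom-vandermonde x y zero =
    trans (cong (λ t → pow q t * (1ℚ * 1ℚ) + 0ℚ)
                (trans (ℕ.+-identityʳ _) (cong (_C 2) (ℕ.+-identityʳ y))))
          (ℚ.+-identityʳ (pow q (y C 2) * 1ℚ))
  qbinom-vandermonde zero y (suc k) = begin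
    ∑ (antidiagonal (suc k)) (vandermondeTerm 0 y)
      ≡⟨ ∑-antidiagonal-suc k (vandermondeTerm 0 y) ⟩
    vandermondeTerm 0 y (0 , suc k) + ∑ (antidiagonal k) (vandermondeTerm 0 y ∘ map₁ suc)
      ≡⟨ cong (vandermondeTerm 0 y (0 , suc k) +_)
              (trans (∑-cong (antidiagonal k) (λ {p} _ → vanish p)) (∑-0 (antidiagonal k))) ⟩
    pow q ((y ℕ.+ 0) C 2 ℕ.+ suc k C 2) * (1ℚ * qbinom y (suc k)) + 0ℚ
      ≡⟨ cong₂ (λ t u → pow q t * u + 0ℚ)
               (trans (cong (λ t → t C 2 ℕ.+ suc k C 2) (ℕ.+-identityʳ y)) (ℕ.+-comm (y C 2) (suc k C 2)))
               (*-identityˡ (qbinom y (suc k))) ⟩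
    pow q (suc k C 2 ℕ.+ y C 2) * qbinom y (suc k) + 0ℚ
      ≡⟨ ℚ.+-identityʳ _ ⟩
    pow q (suc k C 2 ℕ.+ y C 2) * qbinom y (suc k) ∎
    where
    open ≡-Reasoning
    vanish : ∀ p → vandermondeTerm 0 y (map₁ suc p) ≡ 0ℚ
    vanish (a , b) = trans (cong (E *_) (*-zeroˡ (qbinom y b))) (*-zeroʳ E)
      where E = pow q ((y ℕ.+ suc a) C 2 ℕ.+ b C 2)
  qbinom-vandermonde (suc x) y (suc k) = begin
    ∑ (antidiagonal (suc k)) T′
      ≡⟨ ∑-antidiagonal-suc k T′ ⟩
    T (0 , suc k) + ∑ (antidiagonal k) (T′ ∘ map₁ suc)
      ≡⟨ cong (T (0 , suc k) +_) (∑-cong (antidiagonal k) (λ {p} _ → pascal p)) ⟩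
    T (0 , suc k) + ∑ (antidiagonal k) (λ p → T (map₁ suc p) + c * T p)
      ≡⟨ cong (T (0 , suc k) +_)
              (trans (∑-+ (antidiagonal k) (T ∘ map₁ suc) (λ p → c * T p))
                     (cong (∑ (antidiagonal k) (T ∘ map₁ suc) +_) (∑-*ˡ c (antidiagonal k) T))) ⟩
    T (0 , suc k) + (∑ (antidiagonal k) (T ∘ map₁ suc) + c * ∑ (antidiagonal k) T)
      ≡⟨ ℚ.+-assoc (T (0 , suc k)) _ _ ⟨
    T (0 , suc k) + ∑ (antidiagonal k) (T ∘ map₁ suc) + c * ∑ (antidiagonal k) T
      ≡⟨ cong (_+ c * ∑ (antidiagonal k) T) (∑-antidiagonal-suc k T) ⟨
    ∑ (antidiagonal (suc k)) T + c * ∑ (antidiagonal k) T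
      ≡⟨ cong₂ (λ s t → s + c * t) (qbinom-vandermonde x y (suc k)) (qbinom-vandermonde x y k) ⟩
    e * qbinom (x ℕ.+ y) (suc k) + c * (pow q (k C 2 ℕ.+ y C 2) * qbinom (x ℕ.+ y) k)
      ≡⟨ cong (e * qbinom (x ℕ.+ y) (suc k) +_) (pow-absorb k (x ℕ.+ y) (y C 2) qbinom->) ⟨
    e * qbinom (x ℕ.+ y) (suc k) + e * (pow q (x ℕ.+ y ∸ k) * qbinom (x ℕ.+ y) k)
      ≡⟨ trans (sym (ℚ.*-distribˡ-+ e _ _)) (cong (e *_) (ℚ.+-comm (qbinom (x ℕ.+ y) (suc k)) _)) ⟩
    e * qbinom (suc x ℕ.+ y) (suc k) ∎
    where
    open ≡-Reasoning
    T  = vandermondeTerm x y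
    T′ = vandermondeTerm (suc x) y
    c  = pow q (x ℕ.+ y)
    e  = pow q (suc k C 2 ℕ.+ y C 2)
    pascal : ∀ p → T′ (map₁ suc p) ≡ T (map₁ suc p) + c * T p
    pascal (a , b) = vandermondeTerm-pascal x y a b

  module _ (q≢1 : q ≢ 1ℚ) (q≢-1 : q ≢ - 1ℚ) where

    qfact-≢0 : ∀ n → qfact n ≢ 0ℚ
    qfact-≢0 zero    = ℚ.1≢0
    qfact-≢0 (suc n) = *-≢0 (qfact-≢0 n) (1-p≢0 (pow[1+k]≢1 q≢1 q≢-1 n))

    qfact³-≢0 : ∀ a b c → qfact a * qfact b * qfact c ≢ 0ℚ
    qfact³-≢0 a b c = *-≢0 (*-≢0 (qfact-≢0 a) (qfact-≢0 b)) (qfact-≢0 c)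

    qbinom-trinomial : ∀ {n} c a e → c ℕ.+ (a ℕ.+ e) ≡ n →
                       qbinom n c * qbinom (a ℕ.+ e) a * (qfact c * qfact a * qfact e) ≡ qfact n
    qbinom-trinomial c a e refl = begin
      qbinom n c * qbinom (a ℕ.+ e) a * (qfact c * qfact a * qfact e)
        ≡⟨ regroup (qbinom n c) (qbinom (a ℕ.+ e) a) (qfact c) (qfact a) (qfact e) ⟩
      qbinom n c * (qbinom (a ℕ.+ e) a * (qfact e * qfact a) * qfact c)
        ≡⟨ cong (λ t → qbinom n c * (t * qfact c)) (qbinom-qfact a e) ⟩
      qbinom n c * (qfact (a ℕ.+ e) * qfact c)
        ≡⟨ qbinom-qfact c (a ℕ.+ e) ⟩
      qfact n ∎
      where
      open ≡-Reasoning
      n = c ℕ.+ (a ℕ.+ e)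
      regroup : ∀ x y fc fa fe → x * y * (fc * fa * fe) ≡ x * (y * (fe * fa) * fc)
      regroup = solve 5 (λ x y fc fa fe → x :* y :* (fc :* fa :* fe) := x :* (y :* (fe :* fa) :* fc)) refl

    qbinom-swap : ∀ {n} c a → c ℕ.+ a ≤ n →
                  qbinom n c * qbinom (n ∸ c) a ≡ qbinom n a * qbinom (n ∸ a) c
    qbinom-swap {n} c a c+a≤n = *-cancelʳ-≢0 (qfact³-≢0 c a e) (begin
      qbinom n c * qbinom (n ∸ c) a * (qfact c * qfact a * qfact e)
        ≡⟨ cong (λ t → qbinom n c * qbinom t a * (qfact c * qfact a * qfact e))
                (m+n≡o⇒o∸m≡n c c+[a+e]≡n) ⟩
      qbinom n c * qbinom (a ℕ.+ e) a * (qfact c * qfact a * qfact e)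
        ≡⟨ qbinom-trinomial c a e c+[a+e]≡n ⟩
      qfact n
        ≡⟨ qbinom-trinomial a c e a+[c+e]≡n ⟨
      qbinom n a * qbinom (c ℕ.+ e) c * (qfact a * qfact c * qfact e)
        ≡⟨ cong₂ (λ t u → qbinom n a * qbinom t c * (u * qfact e))
                 (sym (m+n≡o⇒o∸m≡n a a+[c+e]≡n)) (*-comm (qfact a) (qfact c)) ⟩
      qbinom n a * qbinom (n ∸ a) c * (qfact c * qfact a * qfact e) ∎)
      where
      open ≡-Reasoning
      e = n ∸ (c ℕ.+ a)
      c+[a+e]≡n : c ℕ.+ (a ℕ.+ e) ≡ n
      c+[a+e]≡n = trans (sym (ℕ.+-assoc c a e)) (ℕ.m+[n∸m]≡n c+a≤n)
      a+[c+e]≡n : a ℕ.+ (c ℕ.+ e) ≡ n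
      a+[c+e]≡n = trans (ℕ.+-comm a (c ℕ.+ e))
                        (trans (ℕ.+-assoc c e a) (trans (cong (c ℕ.+_) (ℕ.+-comm e a)) c+[a+e]≡n))

    qbinom-nest : ∀ {n} y a → y ≤ n →
                  qbinom n (y ℕ.+ a) * qbinom (y ℕ.+ a) a ≡ qbinom n y * qbinom (n ∸ y) a
    qbinom-nest {n} y a y≤n with y ℕ.+ a ℕ.≤? n
    ... | no y+a≰n = begin
      qbinom n (y ℕ.+ a) * qbinom (y ℕ.+ a) a ≡⟨ cong (_* qbinom (y ℕ.+ a) a) (qbinom-> n<y+a) ⟩
      0ℚ * qbinom (y ℕ.+ a) a                 ≡⟨ *-zeroˡ (qbinom (y ℕ.+ a) a) ⟩
      0ℚ                                      ≡⟨ *-zeroʳ (qbinom n y) ⟨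
      qbinom n y * 0ℚ                         ≡⟨ cong (qbinom n y *_) (qbinom-> n∸y<a) ⟨
      qbinom n y * qbinom (n ∸ y) a           ∎
      where
      open ≡-Reasoning
      n<y+a = ℕ.≰⇒> y+a≰n
      n∸y<a = subst (n ∸ y <_) (ℕ.m+n∸m≡n y a) (ℕ.∸-monoˡ-< n<y+a y≤n)
    ... | yes y+a≤n = *-cancelʳ-≢0 (qfact³-≢0 y a e) (begin
      qbinom n (y ℕ.+ a) * qbinom (y ℕ.+ a) a * (qfact y * qfact a * qfact e)
        ≡⟨ regroup (qbinom n (y ℕ.+ a)) (qbinom (y ℕ.+ a) a) (qfact y) (qfact a) (qfact e) ⟩
      qbinom n (y ℕ.+ a) * (qfact e * (qbinom (y ℕ.+ a) a * (qfact y * qfact a)))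
        ≡⟨ cong (λ t → qbinom n (y ℕ.+ a) * (qfact e * t)) (qbinom-qfact′ a y (ℕ.+-comm a y)) ⟩
      qbinom n (y ℕ.+ a) * (qfact e * qfact (y ℕ.+ a))
        ≡⟨ qbinom-qfact′ (y ℕ.+ a) e (ℕ.m+[n∸m]≡n y+a≤n) ⟩
      qfact n
        ≡⟨ qbinom-trinomial y a e y+[a+e]≡n ⟨
      qbinom n y * qbinom (a ℕ.+ e) a * (qfact y * qfact a * qfact e)
        ≡⟨ cong (λ t → qbinom n y * qbinom t a * (qfact y * qfact a * qfact e))
                (m+n≡o⇒o∸m≡n y y+[a+e]≡n) ⟨
      qbinom n y * qbinom (n ∸ y) a * (qfact y * qfact a * qfact e) ∎)
      where
      open ≡-Reasoning
      e = n ∸ (y ℕ.+ a)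
      y+[a+e]≡n : y ℕ.+ (a ℕ.+ e) ≡ n
      y+[a+e]≡n = trans (sym (ℕ.+-assoc y a e)) (ℕ.m+[n∸m]≡n y+a≤n)
      regroup : ∀ x z fy fa fe → x * z * (fy * fa * fe) ≡ x * (fe * (z * (fy * fa)))
      regroup = solve 5 (λ x z fy fa fe → x :* z :* (fy :* fa :* fe) := x :* (fe :* (z :* (fy :* fa)))) refl

    qbin≡qbinom : ∀ n k → qbin q n k ≡ qbinom n k
    qbin≡qbinom n k with n <ᵇ k | ℕ.<ᵇ-reflects-< n k
    ... | true  | ofʸ n<k = sym (qbinom-> n<k)
    ... | false | ofⁿ n≮k = /?-≡ (*-≢0 (qfact-≢0 (n ∸ k)) (qfact-≢0 k))
                                 (sym (qbinom-qfact′ k (n ∸ k) (ℕ.m+[n∸m]≡n (ℕ.≮⇒≥ n≮k))))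

    pochP-cons : ∀ a ν → pochP q q (a ∷ ν) ≡ qfact (a ∸ part ν 0) * pochP q q ν
    pochP-cons a []      = sym (*-identityʳ (qfact a))
    pochP-cons a (b ∷ ν) = refl

    pochP-≢0 : ∀ ν → pochP q q ν ≢ 0ℚ
    pochP-≢0 []      = ℚ.1≢0
    pochP-≢0 (a ∷ ν) =
      subst (_≢ 0ℚ) (sym (pochP-cons a ν)) (*-≢0 (qfact-≢0 (a ∸ part ν 0)) (pochP-≢0 ν))

    qbinomₚ-qfact : ∀ n ν → Linked ℕ._≥_ ν → part ν 0 ≤ n →
                    qbinomₚ n ν * (qfact (n ∸ part ν 0) * pochP q q ν) ≡ qfact n
    qbinomₚ-qfact n []      _  _   = trans (*-identityˡ (qfact n * 1ℚ)) (*-identityʳ (qfact n))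
    qbinomₚ-qfact n (a ∷ ν) ν↘ a≤n = begin
      qbinom n a * qbinomₚ a ν * (qfact (n ∸ a) * pochP q q (a ∷ ν))
        ≡⟨ cong (λ t → qbinom n a * qbinomₚ a ν * (qfact (n ∸ a) * t)) (pochP-cons a ν) ⟩
      qbinom n a * qbinomₚ a ν * (qfact (n ∸ a) * (qfact (a ∸ part ν 0) * pochP q q ν))
        ≡⟨ regroup (qbinom n a) (qbinomₚ a ν) (qfact (n ∸ a)) (qfact (a ∸ part ν 0)) (pochP q q ν) ⟩
      qbinom n a * (qfact (n ∸ a) * (qbinomₚ a ν * (qfact (a ∸ part ν 0) * pochP q q ν)))
        ≡⟨ cong (λ t → qbinom n a * (qfact (n ∸ a) * t))
                (qbinomₚ-qfact a ν (Linked.tail ν↘) (head-≤ ν↘)) ⟩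
      qbinom n a * (qfact (n ∸ a) * qfact a)
        ≡⟨ qbinom-qfact′ a (n ∸ a) (ℕ.m+[n∸m]≡n a≤n) ⟩
      qfact n ∎
      where
      open ≡-Reasoning
      regroup : ∀ x y u v w → x * y * (u * (v * w)) ≡ x * (u * (y * (v * w)))
      regroup = solve 5 (λ x y u v w → x :* y :* (u :* (v :* w)) := x :* (u :* (y :* (v :* w)))) refl

    qbinP≡qbinomₚ : ∀ n ν → Linked ℕ._≥_ ν → qbinP q n ν ≡ qbinomₚ n ν
    qbinP≡qbinomₚ n ν ν↘ with n <ᵇ part ν 0 | ℕ.<ᵇ-reflects-< n (part ν 0)
    qbinP≡qbinomₚ n (a ∷ ν) ν↘ | true | ofʸ n<a =
      sym (trans (cong (_* qbinomₚ a ν) (qbinom-> n<a)) (*-zeroˡ (qbinomₚ a ν)))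
    ... | false | ofⁿ n≮ν₀ =
      /?-≡ (*-≢0 (qfact-≢0 (n ∸ part ν 0)) (pochP-≢0 ν))
           (sym (qbinomₚ-qfact n ν ν↘ (ℕ.≮⇒≥ n≮ν₀)))

    stripProd≡stripWeight : ∀ λ′ μ → stripProd q λ′ μ ≡ stripWeight λ′ μ
    stripProd≡stripWeight λ′ μ =
      trans (cong (List.foldr _*_ 1ℚ) (map-applyUpTo (λ i → i) (factor λ′ μ) (length λ′)))
            (go λ′ μ (factor λ′ μ) (λ _ → refl))
      where
      factor : Partition → Partition → ℕ → ℚ
      factor λ′ μ i = qbin q (part λ′ i ∸ part λ′ (suc i)) (part λ′ i ∸ part μ i)
      go : ∀ λ′ μ F → (∀ i → F i ≡ factor λ′ μ i) →
           List.foldr _*_ 1ℚ (applyUpTo F (length λ′)) ≡ stripWeight λ′ μ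
      go []      μ F F≗ = refl
      go (a ∷ ν) μ F F≗ = cong₂ _*_ (trans (F≗ 0) (qbin≡qbinom (a ∸ part ν 0) (a ∸ part μ 0)))
        (go ν (drop 1 μ) (F ∘ suc) (λ i → trans (F≗ (suc i))
          (cong (λ t → qbin q (part ν i ∸ part ν (suc i)) (part ν i ∸ t)) (sym (part-drop μ i)))))

    -- The strip expansion

    qbinomₚ-shift : ∀ y a ν → part ν 0 ≤ y →
                    qbinomₚ (y ℕ.+ a) ν * qbinom (y ℕ.+ a ∸ part ν 0) a ≡ qbinom (y ℕ.+ a) a * qbinomₚ y ν
    qbinomₚ-shift y a []      _   =
      trans (*-identityˡ (qbinom (y ℕ.+ a) a)) (sym (*-identityʳ (qbinom (y ℕ.+ a) a)))
    qbinomₚ-shift y a (c ∷ ν) c≤y = begin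
      qbinom (y ℕ.+ a) c * qbinomₚ c ν * qbinom (y ℕ.+ a ∸ c) a
        ≡⟨ right-comm (qbinom (y ℕ.+ a) c) (qbinomₚ c ν) (qbinom (y ℕ.+ a ∸ c) a) ⟩
      qbinom (y ℕ.+ a) c * qbinom (y ℕ.+ a ∸ c) a * qbinomₚ c ν
        ≡⟨ cong (_* qbinomₚ c ν) (qbinom-swap c a (ℕ.+-monoˡ-≤ a c≤y)) ⟩
      qbinom (y ℕ.+ a) a * qbinom (y ℕ.+ a ∸ a) c * qbinomₚ c ν
        ≡⟨ cong (λ t → qbinom (y ℕ.+ a) a * qbinom t c * qbinomₚ c ν) (ℕ.m+n∸n≡m y a) ⟩
      qbinom (y ℕ.+ a) a * qbinom y c * qbinomₚ c ν
        ≡⟨ *-assoc (qbinom (y ℕ.+ a) a) (qbinom y c) (qbinomₚ c ν) ⟩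
      qbinom (y ℕ.+ a) a * (qbinom y c * qbinomₚ c ν) ∎
      where
      open ≡-Reasoning
      right-comm : ∀ x u v → x * u * v ≡ x * v * u
      right-comm = solve 3 (λ x u v → x :* u :* v := x :* v :* u) refl

    weight-cons : ∀ n y μ a ν → part ν 0 ≤ y →
      weight n (y ∷ μ) ((y ℕ.+ a) ∷ ν) ≡
        pow q ((y ℕ.+ a) C 2) * qbinom n (y ℕ.+ a) * qbinom (y ℕ.+ a) a * weight y μ ν
    weight-cons n y μ a ν ν₀≤y = begin
      pow q ((y ℕ.+ a) C 2 ℕ.+ nfun ν) * (N * X) * (qbinom (y ℕ.+ a ∸ part ν 0) (y ℕ.+ a ∸ y) * S)
        ≡⟨ cong₂ (λ u t → u * (N * X) * (qbinom (y ℕ.+ a ∸ part ν 0) t * S))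
                 (pow-distribˡ-+-* q ((y ℕ.+ a) C 2) (nfun ν)) (ℕ.m+n∸m≡n y a) ⟩
      E * F * (N * X) * (Z * S)
        ≡⟨ regroup E F N X Z S ⟩
      E * N * (X * Z) * F * S
        ≡⟨ cong (λ t → E * N * t * F * S) (qbinomₚ-shift y a ν ν₀≤y) ⟩
      E * N * (qbinom (y ℕ.+ a) a * qbinomₚ y ν) * F * S
        ≡⟨ regroup′ E N (qbinom (y ℕ.+ a) a) (qbinomₚ y ν) F S ⟩
      E * N * qbinom (y ℕ.+ a) a * weight y μ ν ∎
      where
      open ≡-Reasoning
      E = pow q ((y ℕ.+ a) C 2)
      F = pow q (nfun ν)
      N = qbinom n (y ℕ.+ a)
      X = qbinomₚ (y ℕ.+ a) ν
      Z = qbinom (y ℕ.+ a ∸ part ν 0) a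
      S = stripWeight ν μ
      regroup : ∀ e f n x z s → e * f * (n * x) * (z * s) ≡ e * n * (x * z) * f * s
      regroup = solve 6 (λ e f n x z s → e :* f :* (n :* x) :* (z :* s) := e :* n :* (x :* z) :* f :* s) refl
      regroup′ : ∀ e n u p f s → e * n * (u * p) * f * s ≡ e * n * u * (f * p * s)
      regroup′ = solve 6 (λ e n u p f s → e :* n :* (u :* p) :* f :* s := e :* n :* u :* (f :* p :* s)) refl

    ∑-stripsSplit : ∀ n B y μ a b → y ≤ n → n ≤ B →
      (∀ {ν} → ν ∈ strips y b μ → part ν 0 ≤ y) →
      ∑ (strips y b μ) (weight y μ) ≡ pow q (b C 2 ℕ.+ nfun μ) * qbinom y b * qbinomₚ y μ →
      ∑ (stripsSplit B y μ (a , b)) (weight n (y ∷ μ)) ≡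
        pow q (nfun μ) * qbinom n y * qbinomₚ y μ * vandermondeTerm (n ∸ y) y (a , b)
    ∑-stripsSplit n B y μ a b y≤n n≤B heads≤y ∑strips with y ℕ.+ a ℕ.≤? B
    ... | yes _ = begin
      ∑ (List.map ((y ℕ.+ a) ∷_) (strips y b μ)) (weight n (y ∷ μ))
        ≡⟨ ∑-map ((y ℕ.+ a) ∷_) (strips y b μ) (weight n (y ∷ μ)) ⟩
      ∑ (strips y b μ) (λ ν → weight n (y ∷ μ) ((y ℕ.+ a) ∷ ν))
        ≡⟨ ∑-cong (strips y b μ) (λ {ν} ν∈ → weight-cons n y μ a ν (heads≤y ν∈)) ⟩
      ∑ (strips y b μ) (λ ν → E * Nₐ * Aₐ * weight y μ ν)
        ≡⟨ ∑-*ˡ (E * Nₐ * Aₐ) (strips y b μ) (weight y μ) ⟩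
      E * Nₐ * Aₐ * ∑ (strips y b μ) (weight y μ)
        ≡⟨ cong (E * Nₐ * Aₐ *_) (trans ∑strips (cong (λ t → t * qbinom y b * qbinomₚ y μ)
                                                    (pow-distribˡ-+-* q (b C 2) (nfun μ)))) ⟩
      E * Nₐ * Aₐ * (pow q (b C 2) * F * qbinom y b * qbinomₚ y μ)
        ≡⟨ regroup E Nₐ Aₐ (pow q (b C 2)) F (qbinom y b) (qbinomₚ y μ) ⟩
      E * pow q (b C 2) * (Nₐ * Aₐ) * (F * qbinom y b * qbinomₚ y μ)
        ≡⟨ cong (λ t → E * pow q (b C 2) * t * (F * qbinom y b * qbinomₚ y μ)) (qbinom-nest y a y≤n) ⟩
      E * pow q (b C 2) * (qbinom n y * qbinom (n ∸ y) a) * (F * qbinom y b * qbinomₚ y μ)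
        ≡⟨ regroup′ E (pow q (b C 2)) (qbinom n y) (qbinom (n ∸ y) a) F (qbinom y b) (qbinomₚ y μ) ⟩
      F * qbinom n y * qbinomₚ y μ * (E * pow q (b C 2) * (qbinom (n ∸ y) a * qbinom y b))
        ≡⟨ cong (λ t → F * qbinom n y * qbinomₚ y μ * (t * (qbinom (n ∸ y) a * qbinom y b)))
                (pow-distribˡ-+-* q ((y ℕ.+ a) C 2) (b C 2)) ⟨
      F * qbinom n y * qbinomₚ y μ * vandermondeTerm (n ∸ y) y (a , b) ∎
      where
      open ≡-Reasoning
      E  = pow q ((y ℕ.+ a) C 2)
      F  = pow q (nfun μ)
      Nₐ = qbinom n (y ℕ.+ a)
      Aₐ = qbinom (y ℕ.+ a) a
      regroup : ∀ e x z c f u p → e * x * z * (c * f * u * p) ≡ e * c * (x * z) * (f * u * p)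
      regroup = solve 7 (λ e x z c f u p →
        e :* x :* z :* (c :* f :* u :* p) := e :* c :* (x :* z) :* (f :* u :* p)) refl
      regroup′ : ∀ e c x z f u p → e * c * (x * z) * (f * u * p) ≡ f * x * p * (e * c * (z * u))
      regroup′ = solve 7 (λ e c x z f u p →
        e :* c :* (x :* z) :* (f :* u :* p) := f :* x :* p :* (e :* c :* (z :* u))) refl
    ... | no y+a≰B = sym (begin
      K * (pow q ((y ℕ.+ a) C 2 ℕ.+ b C 2) * (qbinom (n ∸ y) a * qbinom y b))
        ≡⟨ cong (λ t → K * (pow q ((y ℕ.+ a) C 2 ℕ.+ b C 2) * (t * qbinom y b))) (qbinom-> n∸y<a) ⟩
      K * (pow q ((y ℕ.+ a) C 2 ℕ.+ b C 2) * (0ℚ * qbinom y b))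
        ≡⟨ annihilate K (pow q ((y ℕ.+ a) C 2 ℕ.+ b C 2)) (qbinom y b) ⟩
      0ℚ ∎)
      where
      open ≡-Reasoning
      K = pow q (nfun μ) * qbinom n y * qbinomₚ y μ
      n∸y<a : n ∸ y < a
      n∸y<a = subst (n ∸ y <_) (ℕ.m+n∸m≡n y a)
                    (ℕ.∸-monoˡ-< (ℕ.≤-<-trans n≤B (ℕ.≰⇒> y+a≰B)) y≤n)
      annihilate : ∀ k e u → k * (e * (0ℚ * u)) ≡ 0ℚ
      annihilate = solve 3 (λ k e u → k :* (e :* (con 0ℚ :* u)) := con 0ℚ) refl

    ∑-strips : ∀ B m μ n → IsPartition μ → part μ 0 ≤ n → n ≤ B →
               ∑ (strips B m μ) (weight n μ) ≡ pow q (m C 2 ℕ.+ nfun μ) * qbinom n m * qbinomₚ n μ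
    ∑-strips B m (y ∷ μ) n (μ↘ , _ All.∷ μ⁺) y≤n n≤B = begin
      ∑ (concatMap (stripsSplit B y μ) (antidiagonal m)) (weight n (y ∷ μ))
        ≡⟨ ∑-concatMap (stripsSplit B y μ) (antidiagonal m) (weight n (y ∷ μ)) ⟩
      ∑ (antidiagonal m) (λ p → ∑ (stripsSplit B y μ p) (weight n (y ∷ μ)))
        ≡⟨ ∑-cong (antidiagonal m) (λ {p} _ → row-sum p) ⟩
      ∑ (antidiagonal m) (λ p → K * vandermondeTerm (n ∸ y) y p)
        ≡⟨ ∑-*ˡ K (antidiagonal m) (vandermondeTerm (n ∸ y) y) ⟩
      K * ∑ (antidiagonal m) (vandermondeTerm (n ∸ y) y)
        ≡⟨ cong (K *_) (qbinom-vandermonde (n ∸ y) y m) ⟩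
      K * (pow q (m C 2 ℕ.+ y C 2) * qbinom (n ∸ y ℕ.+ y) m)
        ≡⟨ cong₂ (λ u t → K * (u * qbinom t m)) (pow-distribˡ-+-* q (m C 2) (y C 2)) (ℕ.m∸n+n≡m y≤n) ⟩
      K * (pow q (m C 2) * pow q (y C 2) * qbinom n m)
        ≡⟨ regroup (pow q (nfun μ)) (qbinom n y) (qbinomₚ y μ) (pow q (m C 2)) (pow q (y C 2)) (qbinom n m) ⟩
      pow q (m C 2) * (pow q (y C 2) * pow q (nfun μ)) * qbinom n m * (qbinom n y * qbinomₚ y μ)
        ≡⟨ cong (λ t → t * qbinom n m * (qbinom n y * qbinomₚ y μ))
                (trans (cong (pow q (m C 2) *_) (sym (pow-distribˡ-+-* q (y C 2) (nfun μ))))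
                       (sym (pow-distribˡ-+-* q (m C 2) (y C 2 ℕ.+ nfun μ)))) ⟩
      pow q (m C 2 ℕ.+ nfun (y ∷ μ)) * qbinom n m * qbinomₚ n (y ∷ μ) ∎
      where
      open ≡-Reasoning
      K = pow q (nfun μ) * qbinom n y * qbinomₚ y μ
      μ-part = Linked.tail μ↘ , μ⁺
      row-sum : ∀ p → ∑ (stripsSplit B y μ p) (weight n (y ∷ μ)) ≡ K * vandermondeTerm (n ∸ y) y p
      row-sum (a , b) = ∑-stripsSplit n B y μ a b y≤n n≤B
        (λ ν∈ → proj₂ (proj₂ (∈-strips⁻ y b μ μ-part ν∈)))
        (∑-strips y b μ y μ-part (head-≤ μ↘) ℕ.≤-refl)
      regroup : ∀ f x p c d e → f * x * p * (c * d * e) ≡ c * (d * f) * e * (x * p)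
      regroup = solve 6 (λ f x p c d e → f :* x :* p :* (c :* d :* e) := c :* (d :* f) :* e :* (x :* p)) refl
    ∑-strips B zero    [] n _ _ _   = refl
    ∑-strips B (suc k) [] n _ _ n≤B with suc k ℕ.≤? B
    ... | yes _ = begin
      E * (qbinom n (suc k) * 1ℚ) * (qbinom (suc k) (suc k) * 1ℚ) + 0ℚ
        ≡⟨ cong (λ t → E * (qbinom n (suc k) * 1ℚ) * (t * 1ℚ) + 0ℚ) (qbinom-diag (suc k)) ⟩
      E * (qbinom n (suc k) * 1ℚ) * 1ℚ + 0ℚ
        ≡⟨ ℚ.+-identityʳ _ ⟩
      E * (qbinom n (suc k) * 1ℚ) * 1ℚ
        ≡⟨ cong (λ t → E * t * 1ℚ) (*-identityʳ (qbinom n (suc k))) ⟩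
      E * qbinom n (suc k) * 1ℚ ∎
      where
      open ≡-Reasoning
      E = pow q (suc k C 2 ℕ.+ 0)
    ... | no 1+k≰B = sym (begin
      pow q (suc k C 2 ℕ.+ 0) * qbinom n (suc k) * 1ℚ
        ≡⟨ cong (λ t → pow q (suc k C 2 ℕ.+ 0) * t * 1ℚ)
                (qbinom-> (ℕ.≤-<-trans n≤B (ℕ.≰⇒> 1+k≰B))) ⟩
      pow q (suc k C 2 ℕ.+ 0) * 0ℚ * 1ℚ
        ≡⟨ trans (*-identityʳ _) (*-zeroʳ (pow q (suc k C 2 ℕ.+ 0))) ⟩
      0ℚ ∎)
      where open ≡-Reasoning

lemma1 : (q : ℚ) → q ≢ 1ℚ → q ≢ - 1ℚ →
         (n m : ℕ) (μ : Partition) → IsPartition μ → part μ 0 ≤ n →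
         (L : List Partition) → Unique L →
         (∀ λ′ → (λ′ ∈ L) ⇔ (IsPartition λ′ × IsHorizontalStrip m λ′ μ)) →
         pow q (m C 2 ℕ.+ nfun μ) * qbin q n m * qbinP q n μ ≡ rhsSum q n μ L
lemma1 q q≢1 q≢-1 n m μ μ-part μ₀≤n L L! L⇔ = begin
  pow q (m C 2 ℕ.+ nfun μ) * qbin q n m * qbinP q n μ
    ≡⟨ cong₂ (λ s t → pow q (m C 2 ℕ.+ nfun μ) * s * t)
             (qbin≡qbinom q≢1 q≢-1 n m) (qbinP≡qbinomₚ q≢1 q≢-1 n μ (proj₁ μ-part)) ⟩
  pow q (m C 2 ℕ.+ nfun μ) * qbinom n m * qbinomₚ n μ
    ≡⟨ ∑-strips q≢1 q≢-1 (n ℕ.+ m) m μ n μ-part μ₀≤n (ℕ.m≤m+n n m) ⟨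
  ∑ (strips (n ℕ.+ m) m μ) (weight n μ)
    ≡⟨ ∑-cong (strips (n ℕ.+ m) m μ) (λ λ′∈ → sym (summand≡weight (decreasing λ′∈))) ⟩
  ∑ (strips (n ℕ.+ m) m μ) summand
    ≡⟨ ∑-↭ summand (horizontalStrips↭strips μ-part μ₀≤n L! L⇔) ⟨
  rhsSum q n μ L ∎
  where
  open ≡-Reasoning
  open QBinomial q
  summand : Partition → ℚ
  summand λ′ = pow q (nfun λ′) * qbinP q n λ′ * stripProd q λ′ μ
  decreasing : ∀ {λ′} → λ′ ∈ strips (n ℕ.+ m) m μ → Linked ℕ._≥_ λ′
  decreasing λ′∈ = proj₁ (proj₁ (∈-strips⁻ (n ℕ.+ m) m μ μ-part λ′∈))
  summand≡weight : ∀ {λ′} → Linked ℕ._≥_ λ′ → summand λ′ ≡ weight n μ λ′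
  summand≡weight {λ′} λ′↘ = cong₂ (λ s t → pow q (nfun λ′) * s * t)
    (qbinP≡qbinomₚ q≢1 q≢-1 n λ′ λ′↘) (stripProd≡stripWeight q≢1 q≢-1 λ′ μ)
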